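{- Let $S$ be the set of pairs of unlabelled binary trees and define $\sigma_{\mathrm{baxt}}(u) = \bigl(\mathrm{Sh}(\mathrm{inctree}(\mathrm{std}(u)^{ -1})), \mathrm{Sh}(\mathrm{dectree}(\mathrm{std}(u)^{ -1}))\bigr)$ for $u \in \mathcal{A}^*$. Then $\sigma_{\mathrm{baxt}}$ is an abstract shape.
   Context: $\mathcal{A} = \{1,2,3,\ldots\}$ with the usual order; $\mathcal{A}^*$ the free monoid over $\mathcal{A}$. $\mathrm{wt}(u) = (|u|_1,|u|_2,\ldots)$ with $|u|_a$ the number of occurrences of $a$. The standardization $\mathrm{std}(u)$ of a word of length $k$ replaces occurrences of $1$ from left to right by $1,2,\ldots$, then occurrences of $2$ from left to right by the next integers, etc.; it is a permutation in one-line notation, and $\mathrm{std}(u)^{ -1}$ is its inverse in one-line notation. For a word $w$ without repeated letters, $\mathrm{dectree}(w)$ (resp. $\mathrm{inctree}(w)$) is empty if $w = \varepsilon$, and otherwise, writing $w = sms'$ with $m$ the maximum (resp. minimum) letter, has root $m$, left subtree $\mathrm{dectree}(s)$ (resp. $\mathrm{inctree}(s)$), right subtree $\mathrm{dectree}(s')$ (resp. $\mathrm{inctree}(s')$). $\mathrm{Sh}$ denotes the underlying unlabelled rooted binary tree. An abstract shape is a map $\sigma : \mathcal{A}^* \to S$ such that (S1) $\sigma(u) = \sigma(\mathrm{std}(u))$ for all $u$, and (S2) for all $u,v \in \mathcal{A}^*$ and $a \in \mathcal{A}$, if $\mathrm{wt}(u)=\mathrm{wt}(v)$ and $\sigma(u)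 = \sigma(v)$, then $\sigma(ua) = \sigma(va)$ and $\sigma(au) = \sigma(av)$. -}

module Defs where

open import Data.Nat using (ℕ; zero; suc; _+_; _<ᵇ_; _≡ᵇ_; _⊔_; _⊓_)
open import Data.Bool using (Bool; true; false; if_then_else_)
open import Data.List using (List; []; _∷_; length; _++_; reverse)
open import Data.Product using (_×_; _,_)
open import Relation.Binary.PropositionalEquality using (_≡_)

-- Alphabet: the letter a ∈ 𝒜 = {1,2,3,...} is represented by the natural
-- number a (we allow 0 as well; everything below only uses the order, and the
-- statement quantifies over all words).
Letter : Set
Letter = ℕ

Word : Set
Word = List Letter

count : Letter → Word → ℕ
count a [] = 0
count a (b ∷ u) = (if a ≡ᵇ b then 1 else 0) + count a u

SameWeight : Word → Word → Set
SameWeight u v = ∀ (a : Letter) → count a u ≡ count a v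

countLess : Letter → Word → ℕ
countLess a [] = 0
countLess a (b ∷ u) = (if b <ᵇ a then 1 else 0) + countLess a u

stdAux : Word → Word → Word → Word
stdAux u p [] = []
stdAux u p (x ∷ rest) = suc (countLess x u + count x p) ∷ stdAux u (p ++ (x ∷ [])) rest

std : Word → Word
std u = stdAux u [] u

-- 1-based position of the first occurrence of j in w (0 if absent)
positionOf : ℕ → Word → ℕ
positionOf j [] = 0
positionOf j (x ∷ w) = if j ≡ᵇ x then 1 else (if positionOf j w ≡ᵇ 0 then 0 else suc (positionOf j w))

-- inverse of a permutation of {1..k} given in one-line notation
invAux : ℕ → ℕ → Word → Word
invAux zero j w = []
invAux (suc n) j w = positionOf j w ∷ invAux n (suc j) w

inverse : Word → Word
inverse w = invAux (length w) 1 w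

data LTree : Set where
  lleaf : LTree
  lnode : LTree → ℕ → LTree → LTree

data Tree : Set where
  leaf : Tree
  node : Tree → Tree → Tree

Sh : LTree → Tree
Sh lleaf = leaf
Sh (lnode l _ r) = node (Sh l) (Sh r)

maxW : ℕ → Word → ℕ
maxW d [] = d
maxW d (x ∷ w) = x ⊔ maxW d w

minW : ℕ → Word → ℕ
minW d [] = d
minW d (x ∷ w) = x ⊓ minW d w

splitAtLetter : ℕ → Word → Word × Word
splitAtLetter m [] = [] , []
splitAtLetter m (x ∷ w) with m ≡ᵇ x
... | true = [] , w
... | false with splitAtLetter m w
...   | (s , s') = x ∷ s , s'

-- fuel-driven versions; with fuel = length w they compute the trees exactly
dectreeF : ℕ → Word → LTree
dectreeF _ [] = lleaf
dectreeF zero (_ ∷ _) = lleaf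
dectreeF (suc n) (x ∷ w) with splitAtLetter (maxW x w) (x ∷ w)
... | (s , s') = lnode (dectreeF n s) (maxW x w) (dectreeF n s')

inctreeF : ℕ → Word → LTree
inctreeF _ [] = lleaf
inctreeF zero (_ ∷ _) = lleaf
inctreeF (suc n) (x ∷ w) with splitAtLetter (minW x w) (x ∷ w)
... | (s , s') = lnode (inctreeF n s) (minW x w) (inctreeF n s')

dectree : Word → LTree
dectree w = dectreeF (length w) w

inctree : Word → LTree
inctree w = inctreeF (length w) w

record IsAbstractShape {S : Set} (σ : Word → S) : Set where
  field
    S1 : ∀ (u : Word) → σ u ≡ σ (std u)
    S2 : ∀ (u v : Word) (a : Letter) → SameWeight u v → σ u ≡ σ v →
         (σ (u ++ (a ∷ [])) ≡ σ (v ++ (a ∷ []))) × (σ (a ∷ u) ≡ σ (a ∷ v))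

σbaxt : Word → Tree × Tree
σbaxt u = Sh (inctree (inverse (std u))) , Sh (dectree (inverse (std u)))

-- σbaxt u is the pair of shapes of the increasing and the decreasing tree of the
-- permutation ρ = inverse (std u).  Appending a letter a to u makes the new largest value
-- of ρ appear at position i = #{letters of u that are ≤ a}: the increasing tree gains a
-- leaf at in-order position i, while the decreasing tree becomes a new root above the
-- trees of the parts of ρ before and after position i.  Prepending a inserts the new
-- smallest value 1 (raising all others, which changes no shape) at position
-- i = #{letters of u that are < a}, with the roles of the two trees exchanged.  Both
-- positions are determined by the weight of u, which gives (S2); (S1) holds because
-- std is idempotent.

module Submission where

open import Defs
open import Data.Bool using (true; false; T; if_then_else_)
open import Data.Empty using (⊥-elim)
open import Data.List using (List; []; _∷_; _∷ʳ_; length; _++_; map; take; drop)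
open import Data.List.Properties
  using (++-assoc; ++-identityʳ; length-++; length-map; map-++; map-id; take-[]; drop-[]; take++drop≡id)
open import Data.List.Membership.Propositional using (_∈_)
open import Data.List.Membership.Propositional.Properties using (∈-++⁺ʳ)
open import Data.List.Relation.Unary.All as All using (All; []; _∷_)
open import Data.List.Relation.Unary.All.Properties using (++⁺; ++⁻ˡ; ++⁻ʳ; take⁺; drop⁺; map⁺)
open import Data.List.Relation.Unary.Any using (here; there)
open import Data.List.Reverse using (Reverse; reverseView; []; _∶_∶ʳ_)
open import Data.Nat using (ℕ; zero; suc; _+_; _≤_; _<_; _≤′_; ≤′-refl; ≤′-step; z≤n; s≤s; s≤s⁻¹; _≡ᵇ_; _<ᵇ_; _⊓_; _⊔_)
open import Data.Nat.Properties
open import Data.Product using (_×_; _,_; proj₁; proj₂)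
open import Data.Sum using (inj₁; inj₂)
open import Data.Unit using (tt)
open import Function using (id; _∘_)
open import Function.Definitions using (Injective)
open import Relation.Binary using (_Preserves_⟶_; Tri; tri<; tri≈; tri>)
open import Relation.Binary.PropositionalEquality
open import Algebra.Definitions {A = ℕ} _≡_ using (Commutative; Associative; Selective)
open import Relation.Nullary using (¬_; yes; no)

T⇒≡true : ∀ {b} → T b → b ≡ true
T⇒≡true {true} _ = refl

¬T⇒≡false : ∀ {b} → ¬ T b → b ≡ false
¬T⇒≡false {false} _ = refl
¬T⇒≡false {true} ¬t = ⊥-elim (¬t tt)

<ᵇ-true : ∀ {m n} → m < n → (m <ᵇ n) ≡ true
<ᵇ-true m<n = T⇒≡true (<⇒<ᵇ m<n)

<ᵇ-false : ∀ {m n} → n ≤ m → (m <ᵇ n) ≡ false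
<ᵇ-false {m} {n} n≤m = ¬T⇒≡false (λ t → <⇒≱ (<ᵇ⇒< m n t) n≤m)

≡ᵇ-refl : ∀ n → (n ≡ᵇ n) ≡ true
≡ᵇ-refl n = T⇒≡true (≡⇒≡ᵇ n n refl)

≡ᵇ-false : ∀ {m n} → m ≢ n → (m ≡ᵇ n) ≡ false
≡ᵇ-false {m} {n} m≢n = ¬T⇒≡false (λ t → m≢n (≡ᵇ⇒≡ m n t))

≡ᵇ-true⁻¹ : ∀ {m n} → (m ≡ᵇ n) ≡ true → m ≡ n
≡ᵇ-true⁻¹ {m} {n} e = ≡ᵇ⇒≡ m n (subst T (sym e) tt)

≡ᵇ-false⁻¹ : ∀ {m n} → (m ≡ᵇ n) ≡ false → m ≢ n
≡ᵇ-false⁻¹ {m} e refl = subst T e (≡⇒≡ᵇ m m refl)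

-- Counting and standardization

count-++ : ∀ x (p q : Word) → count x (p ++ q) ≡ count x p + count x q
count-++ x [] q = refl
count-++ x (y ∷ p) q rewrite count-++ x p q = sym (+-assoc _ (count x p) (count x q))

countLess-++ : ∀ x (p q : Word) → countLess x (p ++ q) ≡ countLess x p + countLess x q
countLess-++ x [] q = refl
countLess-++ x (y ∷ p) q rewrite countLess-++ x p q = sym (+-assoc _ (countLess x p) (countLess x q))

countLess-zero : ∀ u → countLess 0 u ≡ 0
countLess-zero [] = refl
countLess-zero (x ∷ u) = countLess-zero u

countLess-suc : ∀ b u → countLess (suc b) u ≡ countLess b u + count b u
countLess-suc b [] = refl
countLess-suc b (x ∷ u) with <-cmp x b
... | tri< x<b x≢b _ rewrite <ᵇ-true x<b | <ᵇ-true (m<n⇒m<1+n x<b) | ≡ᵇ-false (≢-sym x≢b)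
                           | countLess-suc b u = refl
... | tri≈ _ refl _ rewrite <ᵇ-false (≤-refl {x}) | <ᵇ-true (n<1+n x) | ≡ᵇ-refl x | countLess-suc x u =
  sym (+-suc (countLess x u) (count x u))
... | tri> _ x≢b b<x rewrite <ᵇ-false (<⇒≤ b<x) | <ᵇ-false {x} {suc b} b<x | ≡ᵇ-false (≢-sym x≢b)
                           | countLess-suc b u = refl

countLess-mono : ∀ {b c} u → b ≤ c → countLess b u ≤ countLess c u
countLess-mono {b} u b≤c = go (≤⇒≤′ b≤c)
  where
  go : ∀ {c} → b ≤′ c → countLess b u ≤ countLess c u
  go ≤′-refl = ≤-refl
  go (≤′-step {c} b≤′c) = ≤-trans (go b≤′c) (≤-trans (m≤m+n _ (count c u)) (≤-reflexive (sym (countLess-suc c u))))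

countLess-≤-length : ∀ b u → countLess b u ≤ length u
countLess-≤-length b [] = z≤n
countLess-≤-length b (x ∷ u) with x <ᵇ b
... | true = s≤s (countLess-≤-length b u)
... | false = m≤n⇒m≤1+n (countLess-≤-length b u)

sameWeight⇒countLess≡ : ∀ u v → SameWeight u v → ∀ b → countLess b u ≡ countLess b v
sameWeight⇒countLess≡ u v wt≡ zero = trans (countLess-zero u) (sym (countLess-zero v))
sameWeight⇒countLess≡ u v wt≡ (suc b) rewrite countLess-suc b u | countLess-suc b v =
  cong₂ _+_ (sameWeight⇒countLess≡ u v wt≡ b) (wt≡ b)

rank : Word → Word → Letter → ℕ
rank u p x = suc (countLess x u + count x p)

rank-<ᵇ : ∀ {u} p x r b → p ++ x ∷ r ≡ u → (rank u p x <ᵇ suc (countLess b u)) ≡ (x <ᵇ b)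
rank-<ᵇ {u} p x r b refl with x <? b
... | yes x<b rewrite <ᵇ-true x<b = <ᵇ-true (s≤s (≤-trans own<next (countLess-mono u x<b)))
  where
  own<next : countLess x u + count x p < countLess (suc x) u
  own<next rewrite countLess-suc x u | count-++ x p (x ∷ r) | ≡ᵇ-refl x =
    +-monoʳ-< (countLess x u) (≤-trans (s≤s (m≤m+n (count x p) (count x r))) (≤-reflexive (sym (+-suc _ _))))
... | no x≮b rewrite <ᵇ-false {x} {b} (≮⇒≥ x≮b) =
  <ᵇ-false (s≤s (≤-trans (countLess-mono u (≮⇒≥ x≮b)) (m≤m+n _ _)))

shift : ℕ → ℕ → ℕ
shift k x = if x <ᵇ k then x else suc x

shift-below : ∀ {k j} → j < k → shift k j ≡ j
shift-below j<k rewrite <ᵇ-true j<k = refl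

shift-above : ∀ {k j} → k ≤ j → shift k j ≡ suc j
shift-above {k} {j} k≤j rewrite <ᵇ-false {j} {k} k≤j = refl

shift-≢ : ∀ k x → k ≢ shift k x
shift-≢ k x with <-cmp x k
... | tri< x<k _ _ rewrite shift-below x<k = ≢-sym (<⇒≢ x<k)
... | tri≈ _ refl _ rewrite shift-above (≤-refl {x}) = <⇒≢ (n<1+n x)
... | tri> _ _ k<x rewrite shift-above (<⇒≤ k<x) = <⇒≢ (m<n⇒m<1+n k<x)

shift-mono : ∀ k → shift k Preserves _<_ ⟶ _<_
shift-mono k {x} {y} x<y with x <? k | y <? k
... | yes x<k | yes y<k rewrite shift-below x<k | shift-below y<k = x<y
... | yes x<k | no y≮k rewrite shift-below x<k | shift-above (≮⇒≥ y≮k) = m<n⇒m<1+n x<y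
... | no x≮k | yes y<k = ⊥-elim (x≮k (<-trans x<y y<k))
... | no x≮k | no y≮k rewrite shift-above (≮⇒≥ x≮k) | shift-above (≮⇒≥ y≮k) = s≤s x<y

rank-∷ʳ : ∀ {u} a p x r → p ++ x ∷ r ≡ u →
  rank (u ∷ʳ a) p x ≡ shift (suc (countLess (suc a) u)) (rank u p x)
rank-∷ʳ {u} a p x r eq rewrite countLess-++ x u (a ∷ []) | rank-<ᵇ p x r (suc a) eq with x ≤? a
... | yes x≤a rewrite <ᵇ-false {a} {x} x≤a | <ᵇ-true {x} {suc a} (s≤s x≤a) = cong (λ c → suc (c + count x p)) (+-identityʳ _)
... | no x≰a rewrite <ᵇ-true {a} {x} (≰⇒> x≰a) | <ᵇ-false {x} {suc a} (≰⇒> x≰a) =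
  cong suc (trans (+-assoc (countLess x u) 1 (count x p)) (+-suc (countLess x u) (count x p)))

stdAux-∷ʳ : ∀ u a p r → p ++ r ≡ u →
  stdAux (u ∷ʳ a) p (r ∷ʳ a) ≡ map (shift (suc (countLess (suc a) u))) (stdAux u p r) ∷ʳ suc (countLess (suc a) u)
stdAux-∷ʳ u a p [] refl
  rewrite ++-identityʳ p | countLess-++ a p (a ∷ []) | <ᵇ-false (≤-refl {a}) | countLess-suc a p | +-identityʳ (countLess a p) = refl
stdAux-∷ʳ u a p (x ∷ r) eq =
  cong₂ _∷_ (rank-∷ʳ a p x r eq) (stdAux-∷ʳ u a (p ∷ʳ x) r (trans (++-assoc p (x ∷ []) r) eq))

std-∷ʳ : ∀ u a → std (u ∷ʳ a) ≡ map (shift (suc (countLess (suc a) u))) (std u) ∷ʳ suc (countLess (suc a) u)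
std-∷ʳ u a = stdAux-∷ʳ u a [] u refl

rank-∷ : ∀ {u} a p x r → p ++ x ∷ r ≡ u → rank (a ∷ u) (a ∷ p) x ≡ shift (suc (countLess a u)) (rank u p x)
rank-∷ {u} a p x r eq rewrite rank-<ᵇ p x r a eq with <-cmp x a
... | tri< x<a x≢a _ rewrite <ᵇ-true x<a | <ᵇ-false {a} {x} (<⇒≤ x<a) | ≡ᵇ-false x≢a = refl
... | tri≈ _ refl _ rewrite <ᵇ-false (≤-refl {x}) | ≡ᵇ-refl x = cong suc (+-suc (countLess x u) (count x p))
... | tri> _ x≢a a<x rewrite <ᵇ-false {x} {a} (<⇒≤ a<x) | <ᵇ-true a<x | ≡ᵇ-false x≢a = refl

stdAux-∷ : ∀ u a p r → p ++ r ≡ u → stdAux (a ∷ u) (a ∷ p) r ≡ map (shift (suc (countLess a u))) (stdAux u p r)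
stdAux-∷ u a p [] eq = refl
stdAux-∷ u a p (x ∷ r) eq =
  cong₂ _∷_ (rank-∷ a p x r eq) (stdAux-∷ u a (p ∷ʳ x) r (trans (++-assoc p (x ∷ []) r) eq))

std-∷ : ∀ u a → std (a ∷ u) ≡ suc (countLess a u) ∷ map (shift (suc (countLess a u))) (std u)
std-∷ u a rewrite <ᵇ-false (≤-refl {a}) =
  cong₂ _∷_ (cong suc (+-identityʳ (countLess a u))) (stdAux-∷ u a [] u refl)

length-stdAux : ∀ u p r → length (stdAux u p r) ≡ length r
length-stdAux u p [] = refl
length-stdAux u p (x ∷ r) = cong suc (length-stdAux u (p ∷ʳ x) r)

length-std : ∀ u → length (std u) ≡ length u
length-std u = length-stdAux u [] u

countLess-stdAux : ∀ u p r b → p ++ r ≡ u → countLess (suc (countLess b u)) (stdAux u p r) ≡ countLess b r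
countLess-stdAux u p [] b eq = refl
countLess-stdAux u p (x ∷ r) b eq rewrite rank-<ᵇ p x r b eq =
  cong (_ +_) (countLess-stdAux u (p ∷ʳ x) r b (trans (++-assoc p (x ∷ []) r) eq))

countLess-std : ∀ u b → countLess (suc (countLess b u)) (std u) ≡ countLess b u
countLess-std u b = countLess-stdAux u [] u b refl

countLess-shift : ∀ k w → countLess (suc k) (map (shift k) w) ≡ countLess k w
countLess-shift k [] = refl
countLess-shift k (y ∷ w) with y <? k
... | yes y<k rewrite shift-below y<k | <ᵇ-true y<k | <ᵇ-true (m<n⇒m<1+n y<k) = cong suc (countLess-shift k w)
... | no y≮k rewrite shift-above (≮⇒≥ y≮k) | <ᵇ-false (≮⇒≥ y≮k) =
  countLess-shift k w

module _ {f : ℕ → ℕ} (f-mono : f Preserves _<_ ⟶ _<_) where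

  <ᵇ-preserved : ∀ x y → (f x <ᵇ f y) ≡ (x <ᵇ y)
  <ᵇ-preserved x y with <-cmp x y
  ... | tri< x<y _ _ rewrite <ᵇ-true x<y = <ᵇ-true (f-mono x<y)
  ... | tri≈ _ refl _ rewrite <ᵇ-false (≤-refl {x}) = <ᵇ-false (≤-refl {f x})
  ... | tri> _ _ y<x rewrite <ᵇ-false (<⇒≤ y<x) = <ᵇ-false (<⇒≤ (f-mono y<x))

  ≡ᵇ-preserved : ∀ x y → (f x ≡ᵇ f y) ≡ (x ≡ᵇ y)
  ≡ᵇ-preserved x y with <-cmp x y
  ... | tri< x<y x≢y _ rewrite ≡ᵇ-false x≢y = ≡ᵇ-false (<⇒≢ (f-mono x<y))
  ... | tri≈ _ refl _ rewrite ≡ᵇ-refl x = ≡ᵇ-refl (f x)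
  ... | tri> _ x≢y y<x rewrite ≡ᵇ-false x≢y = ≡ᵇ-false (≢-sym (<⇒≢ (f-mono y<x)))

  countLess-map : ∀ x u → countLess (f x) (map f u) ≡ countLess x u
  countLess-map x [] = refl
  countLess-map x (y ∷ u) rewrite <ᵇ-preserved y x | countLess-map x u = refl

  count-map : ∀ x u → count (f x) (map f u) ≡ count x u
  count-map x [] = refl
  count-map x (y ∷ u) rewrite ≡ᵇ-preserved x y | count-map x u = refl

  stdAux-map : ∀ u p r → stdAux (map f u) (map f p) (map f r) ≡ stdAux u p r
  stdAux-map u p [] = refl
  stdAux-map u p (x ∷ r) rewrite countLess-map x u | count-map x p =
    cong (rank u p x ∷_) (trans (cong (λ q → stdAux (map f u) q (map f r)) (sym (map-++ f p (x ∷ []))))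
                                 (stdAux-map u (p ∷ʳ x) r))

  std-map : ∀ u → std (map f u) ≡ std u
  std-map u = stdAux-map u [] u

std-idempotent : ∀ u → std (std u) ≡ std u
std-idempotent u = go (reverseView u)
  where
  go : ∀ {u} → Reverse u → std (std u) ≡ std u
  go [] = refl
  go (u ∶ r ∶ʳ a) = begin
      std (std (u ∷ʳ a))                     ≡⟨ cong std (std-∷ʳ u a) ⟩
      std (map sh π ∷ʳ k)                    ≡⟨ std-∷ʳ (map sh π) k ⟩
      map (shift k′) (std (map sh π)) ∷ʳ k′  ≡⟨ cong (λ c → map (shift c) (std (map sh π)) ∷ʳ c) k′≡k ⟩
      map sh (std (map sh π)) ∷ʳ k           ≡⟨ cong (λ v → map sh v ∷ʳ k) (trans (std-map (shift-mono k) π) (go r)) ⟩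
      map sh π ∷ʳ k                          ≡⟨ sym (std-∷ʳ u a) ⟩
      std (u ∷ʳ a)                           ∎
    where
    open ≡-Reasoning
    π = std u
    k = suc (countLess (suc a) u)
    sh = shift k
    k′ = suc (countLess (suc k) (map sh π))
    k′≡k : k′ ≡ k
    k′≡k = cong suc (trans (countLess-shift k π) (countLess-std u (suc a)))

-- Positions and inverse permutations

length-∷ʳ : ∀ {A : Set} (a : A) xs → length (xs ∷ʳ a) ≡ suc (length xs)
length-∷ʳ a xs = trans (length-++ xs) (+-comm (length xs) 1)

insertAt : ℕ → Letter → Word → Word
insertAt i x w = take i w ++ x ∷ drop i w

positionOf-≤-length : ∀ j w → positionOf j w ≤ length w
positionOf-≤-length j [] = z≤n
positionOf-≤-length j (x ∷ w) with j ≡ᵇ x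
... | true = s≤s z≤n
... | false with positionOf j w | positionOf-≤-length j w
...   | zero | _ = z≤n
...   | suc p | p<n = s≤s p<n

positionOf-∷-≢ : ∀ {j k} w → j ≢ k → positionOf j w ≢ 0 → positionOf j (k ∷ w) ≡ suc (positionOf j w)
positionOf-∷-≢ {j} w j≢k p≢0 rewrite ≡ᵇ-false j≢k with positionOf j w
... | zero = ⊥-elim (p≢0 refl)
... | suc p = refl

positionOf-∷ʳ-≢ : ∀ {j k} w → j ≢ k → positionOf j (w ∷ʳ k) ≡ positionOf j w
positionOf-∷ʳ-≢ [] j≢k rewrite ≡ᵇ-false j≢k = refl
positionOf-∷ʳ-≢ (x ∷ w) j≢k rewrite positionOf-∷ʳ-≢ w j≢k = refl

positionOf-∷ʳ-new : ∀ {k} w → All (k ≢_) w → positionOf k (w ∷ʳ k) ≡ suc (length w)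
positionOf-∷ʳ-new {k} [] [] rewrite ≡ᵇ-refl k = refl
positionOf-∷ʳ-new (x ∷ w) (k≢x ∷ k∉w) rewrite ≡ᵇ-false k≢x | positionOf-∷ʳ-new w k∉w = refl

positionOf-map : ∀ {f} → f Preserves _<_ ⟶ _<_ → ∀ j w → positionOf (f j) (map f w) ≡ positionOf j w
positionOf-map f-mono j [] = refl
positionOf-map f-mono j (x ∷ w) rewrite ≡ᵇ-preserved f-mono j x | positionOf-map f-mono j w = refl

positionOf-shift-below : ∀ {j k} π → j < k → positionOf j (map (shift k) π) ≡ positionOf j π
positionOf-shift-below {j} {k} π j<k =
  trans (cong (λ z → positionOf z (map (shift k) π)) (sym (shift-below j<k))) (positionOf-map (shift-mono k) j π)

positionOf-shift-above : ∀ {j k} π → k ≤ j → positionOf (suc j) (map (shift k) π) ≡ positionOf j π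
positionOf-shift-above {j} {k} π k≤j =
  trans (cong (λ z → positionOf z (map (shift k) π)) (sym (shift-above k≤j))) (positionOf-map (shift-mono k) j π)

module _ (π : Word) (k : ℕ) where

  positionOf-shift-∷ʳ-below : ∀ {j} → j < k → positionOf j (map (shift k) π ∷ʳ k) ≡ positionOf j π
  positionOf-shift-∷ʳ-below j<k = trans (positionOf-∷ʳ-≢ (map (shift k) π) (<⇒≢ j<k)) (positionOf-shift-below π j<k)

  positionOf-shift-∷ʳ-at : positionOf k (map (shift k) π ∷ʳ k) ≡ suc (length π)
  positionOf-shift-∷ʳ-at =
    trans (positionOf-∷ʳ-new (map (shift k) π) (map⁺ (All.universal (shift-≢ k) π))) (cong suc (length-map (shift k) π))

  positionOf-shift-∷ʳ-above : ∀ {j} → k ≤ j → positionOf (suc j) (map (shift k) π ∷ʳ k) ≡ positionOf j π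
  positionOf-shift-∷ʳ-above k≤j =
    trans (positionOf-∷ʳ-≢ (map (shift k) π) (≢-sym (<⇒≢ (s≤s k≤j)))) (positionOf-shift-above π k≤j)

-- positionOf is 0 exactly on absent values: all of 1, …, length π occur in π.
CoversRange : Word → Set
CoversRange π = ∀ j → 1 ≤ j → j ≤ length π → positionOf j π ≢ 0

std-covers : ∀ u → CoversRange (std u)
std-covers u = go (reverseView u)
  where
  go : ∀ {u} → Reverse u → CoversRange (std u)
  go [] j 1≤j j≤0 = ⊥-elim (<⇒≱ 1≤j j≤0)
  go (u ∶ r ∶ʳ a) j 1≤j j≤n+1 =
    subst (λ π → positionOf j π ≢ 0) (sym (std-∷ʳ u a)) (step j 1≤j j≤n+1 (<-cmp j k))
    where
    π = std u
    k = suc (countLess (suc a) u)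
    ≤length-π : ∀ {j} → j ≤ length u → j ≤ length π
    ≤length-π = subst (_ ≤_) (sym (length-std u))
    step : ∀ j → 1 ≤ j → j ≤ length (std (u ∷ʳ a)) → Tri (j < k) (j ≡ k) (k < j) →
           positionOf j (map (shift k) π ∷ʳ k) ≢ 0
    step j 1≤j _ (tri< j<k _ _) = subst (_≢ 0) (sym (positionOf-shift-∷ʳ-below π k j<k))
      (go r j 1≤j (≤length-π (≤-trans (s≤s⁻¹ j<k) (countLess-≤-length (suc a) u))))
    step j _ _ (tri≈ _ refl _) = subst (_≢ 0) (sym (positionOf-shift-∷ʳ-at π k)) (λ ())
    step (suc j) _ j<n+1 (tri> _ _ k<j) = subst (_≢ 0) (sym (positionOf-shift-∷ʳ-above π k (s≤s⁻¹ k<j)))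
      (go r j (≤-trans (s≤s z≤n) (s≤s⁻¹ k<j))
        (≤length-π (s≤s⁻¹ (subst (suc j ≤_) (trans (length-std (u ∷ʳ a)) (length-∷ʳ a u)) j<n+1))))

module InverseInsertion (w w′ : Word) (h : ℕ → ℕ) (i x : ℕ)
  (below : ∀ j → 1 ≤ j → j ≤ i → positionOf j w′ ≡ h (positionOf j w))
  (at : positionOf (suc i) w′ ≡ x)
  (above : ∀ j → i < j → j ≤ length w → positionOf (suc j) w′ ≡ h (positionOf j w))
  where

  private
    n = length w

    invAux-above : ∀ c j → i < j → j + c ≤ suc n → invAux c (suc j) w′ ≡ map h (invAux c j w)
    invAux-above zero j _ _ = refl
    invAux-above (suc c) j i<j j+c<n+1 = cong₂ _∷_
      (above j i<j (s≤s⁻¹ (≤-trans (s≤s (m≤m+n j c)) (subst (_≤ suc n) (+-suc j c) j+c<n+1))))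
      (invAux-above c (suc j) (m<n⇒m<1+n i<j) (subst (_≤ suc n) (+-suc j c) j+c<n+1))

    invAux-insert : ∀ d c j → 1 ≤ j → suc i ≡ d + j → d ≤ c → j + c ≤ suc n →
      invAux (suc c) j w′ ≡ insertAt d x (map h (invAux c j w))
    invAux-insert zero c _ _ refl _ bound = cong₂ _∷_ at (invAux-above c (suc i) (n<1+n i) bound)
    invAux-insert (suc d) (suc c) j 1≤j i+1≡ (s≤s d≤c) bound = cong₂ _∷_
      (below j 1≤j (subst (j ≤_) (sym (suc-injective i+1≡)) (m≤n+m j d)))
      (invAux-insert d c (suc j) (s≤s z≤n) (trans i+1≡ (sym (+-suc d j))) d≤c (subst (_≤ suc n) (+-suc j c) bound))

  inverse-insert : length w′ ≡ suc n → i ≤ n → inverse w′ ≡ insertAt i x (map h (inverse w))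
  inverse-insert len≡ i≤n rewrite len≡ = invAux-insert i n 1 ≤-refl (+-comm 1 i) i≤n ≤-refl

inverse-shift-∷ʳ : ∀ π i → i ≤ length π →
  inverse (map (shift (suc i)) π ∷ʳ suc i) ≡ insertAt i (suc (length π)) (inverse π)
inverse-shift-∷ʳ π i i≤n =
  trans (inverse-insert (trans (length-∷ʳ k (map (shift k) π)) (cong suc (length-map (shift k) π))) i≤n)
        (cong (insertAt i (suc (length π))) (map-id (inverse π)))
  where
  k = suc i
  open InverseInsertion π (map (shift k) π ∷ʳ k) id i (suc (length π))
    (λ j _ j≤i → positionOf-shift-∷ʳ-below π k (s≤s j≤i))
    (positionOf-shift-∷ʳ-at π k)
    (λ j i<j _ → positionOf-shift-∷ʳ-above π k i<j)

inverse-shift-∷ : ∀ π i → i ≤ length π → CoversRange π →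
  inverse (suc i ∷ map (shift (suc i)) π) ≡ insertAt i 1 (map suc (inverse π))
inverse-shift-∷ π i i≤n covers = inverse-insert (cong suc (length-map (shift k) π)) i≤n
  where
  k = suc i
  π′ = map (shift k) π
  at : positionOf k (k ∷ π′) ≡ 1
  at rewrite ≡ᵇ-refl k = refl
  below : ∀ j → 1 ≤ j → j ≤ i → positionOf j (k ∷ π′) ≡ suc (positionOf j π)
  below j 1≤j j≤i = trans (positionOf-∷-≢ π′ (<⇒≢ (s≤s j≤i)) (subst (_≢ 0) (sym shifted) (covers j 1≤j (≤-trans j≤i i≤n))))
                          (cong suc shifted)
    where shifted = positionOf-shift-below π (s≤s j≤i)
  above : ∀ j → i < j → j ≤ length π → positionOf (suc j) (k ∷ π′) ≡ suc (positionOf j π)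
  above j i<j j≤n = trans (positionOf-∷-≢ π′ (≢-sym (<⇒≢ (s≤s i<j))) (subst (_≢ 0) (sym shifted) (covers j (≤-trans (s≤s z≤n) i<j) j≤n)))
                          (cong suc shifted)
    where shifted = positionOf-shift-above π i<j
  open InverseInsertion π (k ∷ π′) suc i 1 below at above

inverse-≤-length : ∀ w → All (_≤ length w) (inverse w)
inverse-≤-length w = go (length w) 1
  where
  go : ∀ c j → All (_≤ length w) (invAux c j w)
  go zero j = []
  go (suc c) j = positionOf-≤-length j w ∷ go c (suc j)

inverse-≢0 : ∀ π → CoversRange π → All (_≢ 0) (inverse π)
inverse-≢0 π covers = go (length π) 1 (s≤s z≤n) ≤-refl
  where
  go : ∀ c j → 1 ≤ j → j + c ≤ suc (length π) → All (_≢ 0) (invAux c j π)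
  go zero j _ _ = []
  go (suc c) j 1≤j bound = covers j 1≤j (s≤s⁻¹ (≤-trans (s≤s (m≤m+n j c)) (subst (_≤ suc (length π)) (+-suc j c) bound)))
                         ∷ go c (suc j) (s≤s z≤n) (subst (_≤ suc (length π)) (+-suc j c) bound)

-- Shapes of increasing and decreasing trees

size : Tree → ℕ
size leaf = 0
size (node l r) = size l + suc (size r)

data Side (i n : ℕ) : Set where
  left  : i ≤ n → Side i n
  right : ∀ j → i ≡ suc (n + j) → Side i n

side : ∀ i n → Side i n
side zero n = left z≤n
side (suc i) zero = right i refl
side (suc i) (suc n) with side i n
... | left i≤n = left (s≤s i≤n)
... | right j i≡ = right j (cong suc i≡)

-- Positions count the nodes of a tree in symmetric (in-)order: `insertNode i t` adds a
-- node without children at position i, `takeNodes i t` and `dropNodes i t` keep the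
-- first i nodes, resp. the others, as in a binary search tree.
insertNode : ℕ → Tree → Tree
insertNode i leaf = node leaf leaf
insertNode i (node l r) with side i (size l)
... | left _ = node (insertNode i l) r
... | right j _ = node l (insertNode j r)

takeNodes : ℕ → Tree → Tree
takeNodes i leaf = leaf
takeNodes i (node l r) with side i (size l)
... | left _ = takeNodes i l
... | right j _ = node l (takeNodes j r)

dropNodes : ℕ → Tree → Tree
dropNodes i leaf = leaf
dropNodes i (node l r) with side i (size l)
... | left _ = node (dropNodes i l) r
... | right j _ = dropNodes j r

take-++ˡ : ∀ {A : Set} i (s t : List A) → i ≤ length s → take i (s ++ t) ≡ take i s
take-++ˡ zero s t _ = refl
take-++ˡ (suc i) (x ∷ s) t (s≤s i≤n) = cong (x ∷_) (take-++ˡ i s t i≤n)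

drop-++ˡ : ∀ {A : Set} i (s t : List A) → i ≤ length s → drop i (s ++ t) ≡ drop i s ++ t
drop-++ˡ zero s t _ = refl
drop-++ˡ (suc i) (x ∷ s) t (s≤s i≤n) = drop-++ˡ i s t i≤n

take-++-∷ : ∀ {A : Set} j (s : List A) m t → take (suc (length s + j)) (s ++ m ∷ t) ≡ s ++ m ∷ take j t
take-++-∷ j [] m t = refl
take-++-∷ j (x ∷ s) m t = cong (x ∷_) (take-++-∷ j s m t)

drop-++-∷ : ∀ {A : Set} j (s : List A) m t → drop (suc (length s + j)) (s ++ m ∷ t) ≡ drop j t
drop-++-∷ j [] m t = refl
drop-++-∷ j (x ∷ s) m t = drop-++-∷ j s m t

splitAtLetter-++-∷ : ∀ m (s s′ : Word) → All (m ≢_) s → splitAtLetter m (s ++ m ∷ s′) ≡ (s , s′)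
splitAtLetter-++-∷ m [] s′ _ rewrite ≡ᵇ-refl m = refl
splitAtLetter-++-∷ m (x ∷ s) s′ (m≢x ∷ m∉s) rewrite ≡ᵇ-false m≢x | splitAtLetter-++-∷ m s s′ m∉s = refl

splitAtLetter-∈ : ∀ m w → m ∈ w → proj₁ (splitAtLetter m w) ++ m ∷ proj₂ (splitAtLetter m w) ≡ w
splitAtLetter-∈ m (x ∷ w) m∈ with m ≡ᵇ x in eq
splitAtLetter-∈ m (x ∷ w) m∈ | true = cong (_∷ w) (≡ᵇ-true⁻¹ eq)
splitAtLetter-∈ m (x ∷ w) (here m≡x) | false = ⊥-elim (≡ᵇ-false⁻¹ eq m≡x)
splitAtLetter-∈ m (x ∷ w) (there m∈) | false with splitAtLetter m w | splitAtLetter-∈ m w m∈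
... | (s , s′) | ih = cong (x ∷_) ih

splitAtLetter-∉ˡ : ∀ m w → All (m ≢_) (proj₁ (splitAtLetter m w))
splitAtLetter-∉ˡ m [] = []
splitAtLetter-∉ˡ m (x ∷ w) with m ≡ᵇ x in eq
... | true = []
... | false with splitAtLetter m w | splitAtLetter-∉ˡ m w
...   | (s , s′) | ih = ≡ᵇ-false⁻¹ eq ∷ ih

length-++-∷-< : ∀ {A : Set} (s : List A) m s′ → length s < length (s ++ m ∷ s′) × length s′ < length (s ++ m ∷ s′)
length-++-∷-< s m s′ rewrite length-++ s {m ∷ s′} | +-suc (length s) (length s′) =
  s≤s (m≤m+n (length s) (length s′)) , s≤s (m≤n+m (length s′) (length s))

module CartesianShape
  (_∙_ : ℕ → ℕ → ℕ) (∙-comm : Commutative _∙_) (∙-assoc : Associative _∙_) (∙-sel : Selective _∙_)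
  (extremum : ℕ → Word → ℕ)
  (extremum-[] : ∀ d → extremum d [] ≡ d)
  (extremum-∷ : ∀ d x w → extremum d (x ∷ w) ≡ x ∙ extremum d w)
  (treeF : ℕ → Word → LTree)
  (treeF-[] : ∀ n → treeF n [] ≡ lleaf)
  (treeF-∷ : ∀ n x w → treeF (suc n) (x ∷ w) ≡
     lnode (treeF n (proj₁ (splitAtLetter (extremum x w) (x ∷ w)))) (extremum x w)
           (treeF n (proj₂ (splitAtLetter (extremum x w) (x ∷ w)))))
  where

  _≽_ : ℕ → ℕ → Set
  m ≽ y = m ∙ y ≡ m

  ≽-refl : ∀ x → x ≽ x
  ≽-refl x with ∙-sel x x
  ... | inj₁ e = e
  ... | inj₂ e = e

  ≽-trans : ∀ {x y z} → x ≽ y → y ≽ z → x ≽ z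
  ≽-trans {x} {y} {z} x≽y y≽z = begin
    x ∙ z        ≡⟨ cong (_∙ z) (sym x≽y) ⟩
    (x ∙ y) ∙ z  ≡⟨ ∙-assoc x y z ⟩
    x ∙ (y ∙ z)  ≡⟨ cong (x ∙_) y≽z ⟩
    x ∙ y        ≡⟨ x≽y ⟩
    x            ∎
    where open ≡-Reasoning

  extremum-∈ : ∀ d w → extremum d w ∈ d ∷ w
  extremum-∈ d [] = here (extremum-[] d)
  extremum-∈ d (x ∷ w) rewrite extremum-∷ d x w with ∙-sel x (extremum d w)
  ... | inj₁ e rewrite e = there (here refl)
  ... | inj₂ e rewrite e with extremum-∈ d w
  ...   | here e≡d = here e≡d
  ...   | there e∈w = there (there e∈w)

  extremum-≽ : ∀ d w → All (extremum d w ≽_) (d ∷ w)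
  extremum-≽ d [] rewrite extremum-[] d = ≽-refl d ∷ []
  extremum-≽ d (x ∷ w) rewrite extremum-∷ d x w with extremum-≽ d w | ∙-sel x (extremum d w)
  ... | e≽d ∷ e≽w | inj₁ x≽e rewrite x≽e = ≽-trans x≽e e≽d ∷ ≽-refl x ∷ All.map (≽-trans x≽e) e≽w
  ... | e≽d ∷ e≽w | inj₂ x∙e≡e rewrite x∙e≡e = e≽d ∷ trans (∙-comm _ x) x∙e≡e ∷ e≽w

  extremum-unique : ∀ {m} d w → m ∈ d ∷ w → All (m ≽_) (d ∷ w) → extremum d w ≡ m
  extremum-unique {m} d w m∈ m≽ = begin
    e      ≡⟨ sym (All.lookup (extremum-≽ d w) m∈) ⟩
    e ∙ m  ≡⟨ ∙-comm e m ⟩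
    m ∙ e  ≡⟨ All.lookup m≽ (extremum-∈ d w) ⟩
    m      ∎
    where
    open ≡-Reasoning
    e = extremum d w

  extremum-split : ∀ x w →
    proj₁ (splitAtLetter (extremum x w) (x ∷ w)) ++ extremum x w ∷ proj₂ (splitAtLetter (extremum x w) (x ∷ w)) ≡ x ∷ w
  extremum-split x w = splitAtLetter-∈ (extremum x w) (x ∷ w) (extremum-∈ x w)

  treeF-fuel : ∀ f g w → length w ≤ f → length w ≤ g → treeF f w ≡ treeF g w
  treeF-fuel f g [] _ _ = trans (treeF-[] f) (sym (treeF-[] g))
  treeF-fuel (suc f) (suc g) (x ∷ w) (s≤s w≤f) (s≤s w≤g) = begin
    treeF (suc f) (x ∷ w)             ≡⟨ treeF-∷ f x w ⟩
    lnode (treeF f s) m (treeF f s′)  ≡⟨ cong₂ (λ l r → lnode l m r) (treeF-fuel f g s (fits s s< w≤f) (fits s s< w≤g))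
                                                                     (treeF-fuel f g s′ (fits s′ s′< w≤f) (fits s′ s′< w≤g)) ⟩
    lnode (treeF g s) m (treeF g s′)  ≡⟨ sym (treeF-∷ g x w) ⟩
    treeF (suc g) (x ∷ w)             ∎
    where
    open ≡-Reasoning
    m = extremum x w
    s = proj₁ (splitAtLetter m (x ∷ w))
    s′ = proj₂ (splitAtLetter m (x ∷ w))
    parts< = subst (λ v → length s < length v × length s′ < length v) (extremum-split x w) (length-++-∷-< s m s′)
    s< = proj₁ parts<
    s′< = proj₂ parts<
    fits : ∀ {h} v → length v < suc (length w) → length w ≤ h → length v ≤ h
    fits _ v< w≤h = ≤-trans (s≤s⁻¹ v<) w≤h

  shape : Word → Tree
  shape w = Sh (treeF (length w) w)

  shape-[] : shape [] ≡ leaf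
  shape-[] = cong Sh (treeF-[] 0)

  treeF-++-∷ : ∀ x w s m s′ → x ∷ w ≡ s ++ m ∷ s′ → All (m ≽_) (s ++ s′) → All (m ≢_) s →
    treeF (suc (length w)) (x ∷ w) ≡ lnode (treeF (length s) s) m (treeF (length s′) s′)
  treeF-++-∷ x w s m s′ eq m≽ m∉s = begin
    treeF (suc (length w)) (x ∷ w)                              ≡⟨ treeF-∷ (length w) x w ⟩
    node-at (extremum x w)                                      ≡⟨ cong node-at extremum≡m ⟩
    node-at m                                                   ≡⟨ cong (λ p → lnode (treeF (length w) (proj₁ p)) m (treeF (length w) (proj₂ p)))
                                                                        (trans (cong (splitAtLetter m) eq) (splitAtLetter-++-∷ m s s′ m∉s)) ⟩
    lnode (treeF (length w) s) m (treeF (length w) s′)          ≡⟨ cong₂ (λ l r → lnode l m r) (treeF-fuel _ _ s (s≤s⁻¹ (proj₁ parts<)) ≤-refl)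
                                                                                               (treeF-fuel _ _ s′ (s≤s⁻¹ (proj₂ parts<)) ≤-refl) ⟩
    lnode (treeF (length s) s) m (treeF (length s′) s′)         ∎
    where
    open ≡-Reasoning
    node-at : ℕ → LTree
    node-at e = lnode (treeF (length w) (proj₁ (splitAtLetter e (x ∷ w)))) e (treeF (length w) (proj₂ (splitAtLetter e (x ∷ w))))
    extremum≡m : extremum x w ≡ m
    extremum≡m = extremum-unique x w (subst (m ∈_) (sym eq) (∈-++⁺ʳ s (here refl)))
      (subst (All (m ≽_)) (sym eq) (++⁺ (++⁻ˡ s m≽) (≽-refl m ∷ ++⁻ʳ s m≽)))
    parts< = subst (λ v → length s < length v × length s′ < length v) (sym eq) (length-++-∷-< s m s′)

  shape-++-∷ : ∀ s m s′ → All (m ≽_) (s ++ s′) → All (m ≢_) s → shape (s ++ m ∷ s′) ≡ node (shape s) (shape s′)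
  shape-++-∷ [] m s′ m≽ m∉s = cong Sh (treeF-++-∷ m s′ [] m s′ refl m≽ m∉s)
  shape-++-∷ (y ∷ s) m s′ m≽ m∉s = cong Sh (treeF-++-∷ y (s ++ m ∷ s′) (y ∷ s) m s′ refl m≽ m∉s)

  data Cartesian : Word → Set where
    []    : Cartesian []
    split : ∀ {s s′} m → All (m ≽_) (s ++ s′) → All (m ≢_) s → Cartesian s → Cartesian s′ → Cartesian (s ++ m ∷ s′)

  cartesian : ∀ w → Cartesian w
  cartesian w = go (length w) w ≤-refl
    where
    go : ∀ f w → length w ≤ f → Cartesian w
    go f [] _ = []
    go (suc f) (x ∷ w) (s≤s w≤f) =
      subst Cartesian (extremum-split x w)
        (split m (++⁺ (++⁻ˡ s m≽) (All.tail (++⁻ʳ s m≽))) (splitAtLetter-∉ˡ m (x ∷ w))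
               (go f s (≤-trans (s≤s⁻¹ (proj₁ parts<)) w≤f)) (go f s′ (≤-trans (s≤s⁻¹ (proj₂ parts<)) w≤f)))
      where
      m = extremum x w
      s = proj₁ (splitAtLetter m (x ∷ w))
      s′ = proj₂ (splitAtLetter m (x ∷ w))
      m≽ : All (m ≽_) (s ++ m ∷ s′)
      m≽ = subst (All (m ≽_)) (sym (extremum-split x w)) (extremum-≽ x w)
      parts< = subst (λ v → length s < length v × length s′ < length v) (extremum-split x w) (length-++-∷-< s m s′)

  size-shape : ∀ {w} → Cartesian w → size (shape w) ≡ length w
  size-shape [] = cong size shape-[]
  size-shape (split {s} {s′} m m≽ m∉s cs cs′)
    rewrite shape-++-∷ s m s′ m≽ m∉s | size-shape cs | size-shape cs′ | length-++ s {m ∷ s′} = refl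

  shape-take : ∀ {w} → Cartesian w → ∀ i → shape (take i w) ≡ takeNodes i (shape w)
  shape-take [] i rewrite take-[] {A = Letter} i | shape-[] = refl
  shape-take (split {s} {s′} m m≽ m∉s cs cs′) i rewrite shape-++-∷ s m s′ m≽ m∉s with side i (size (shape s))
  ... | left i≤ rewrite take-++ˡ i s (m ∷ s′) (≤-trans i≤ (≤-reflexive (size-shape cs))) = shape-take cs i
  ... | right j i≡ rewrite trans i≡ (cong (λ z → suc (z + j)) (size-shape cs)) | take-++-∷ j s m s′ =
    trans (shape-++-∷ s m (take j s′) (++⁺ (++⁻ˡ s m≽) (take⁺ j (++⁻ʳ s m≽))) m∉s)
          (cong (node (shape s)) (shape-take cs′ j))

  shape-drop : ∀ {w} → Cartesian w → ∀ i → shape (drop i w) ≡ dropNodes i (shape w)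
  shape-drop [] i rewrite drop-[] {A = Letter} i | shape-[] = refl
  shape-drop (split {s} {s′} m m≽ m∉s cs cs′) i rewrite shape-++-∷ s m s′ m≽ m∉s with side i (size (shape s))
  ... | left i≤ rewrite drop-++ˡ i s (m ∷ s′) (≤-trans i≤ (≤-reflexive (size-shape cs))) =
    trans (shape-++-∷ (drop i s) m s′ (++⁺ (drop⁺ i (++⁻ˡ s m≽)) (++⁻ʳ s m≽)) (drop⁺ i m∉s))
          (cong (λ t → node t (shape s′)) (shape-drop cs i))
  ... | right j i≡ rewrite trans i≡ (cong (λ z → suc (z + j)) (size-shape cs)) | drop-++-∷ j s m s′ = shape-drop cs′ j

  shape-insertAt-dominated : ∀ {w} → Cartesian w → ∀ i M → All (_≽ M) w → All (M ≢_) w →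
    shape (insertAt i M w) ≡ insertNode i (shape w)
  shape-insertAt-dominated [] i M _ _ rewrite take-[] {A = Letter} i | drop-[] {A = Letter} i =
    trans (shape-++-∷ [] M [] [] []) (trans (cong₂ node shape-[] shape-[]) (cong (insertNode i) (sym shape-[])))
  shape-insertAt-dominated (split {s} {s′} m m≽ m∉s cs cs′) i M ≽M M∉
    rewrite shape-++-∷ s m s′ m≽ m∉s with side i (size (shape s))
  ... | left i≤ rewrite take-++ˡ i s (m ∷ s′) (≤-trans i≤ (≤-reflexive (size-shape cs)))
                      | drop-++ˡ i s (m ∷ s′) (≤-trans i≤ (≤-reflexive (size-shape cs)))
                      | sym (++-assoc (take i s) (M ∷ drop i s) (m ∷ s′)) =
    trans (shape-++-∷ (insertAt i M s) m s′
             (++⁺ (++⁺ (take⁺ i (++⁻ˡ s m≽)) (m≽M ∷ drop⁺ i (++⁻ˡ s m≽))) (++⁻ʳ s m≽))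
             (++⁺ (take⁺ i m∉s) (≢-sym (All.head (++⁻ʳ s M∉)) ∷ drop⁺ i m∉s)))
          (cong (λ t → node t (shape s′)) (shape-insertAt-dominated cs i M (++⁻ˡ s ≽M) (++⁻ˡ s M∉)))
    where
    m≽M : m ≽ M
    m≽M = All.head (++⁻ʳ s ≽M)
  ... | right j i≡ rewrite trans i≡ (cong (λ z → suc (z + j)) (size-shape cs)) | take-++-∷ j s m s′ | drop-++-∷ j s m s′
                         | ++-assoc s (m ∷ take j s′) (M ∷ drop j s′) =
    trans (shape-++-∷ s m (insertAt j M s′)
             (++⁺ (++⁻ˡ s m≽) (++⁺ (take⁺ j (++⁻ʳ s m≽)) (m≽M ∷ drop⁺ j (++⁻ʳ s m≽)))) m∉s)
          (cong (node (shape s)) (shape-insertAt-dominated cs′ j M (All.tail (++⁻ʳ s ≽M)) (All.tail (++⁻ʳ s M∉))))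
    where
    m≽M : m ≽ M
    m≽M = All.head (++⁻ʳ s ≽M)

  shape-insertAt-dominant : ∀ w i M → All (M ≽_) w → All (M ≢_) w →
    shape (insertAt i M w) ≡ node (takeNodes i (shape w)) (dropNodes i (shape w))
  shape-insertAt-dominant w i M M≽ M∉ =
    trans (shape-++-∷ (take i w) M (drop i w) (subst (All (M ≽_)) (sym (take++drop≡id i w)) M≽) (take⁺ i M∉))
          (cong₂ node (shape-take (cartesian w) i) (shape-drop (cartesian w) i))

  shape-map : ∀ {f} → (∀ x y → f x ∙ f y ≡ f (x ∙ y)) → Injective _≡_ _≡_ f → ∀ w → shape (map f w) ≡ shape w
  shape-map {f} f-hom f-inj w = go (cartesian w)
    where
    go : ∀ {w} → Cartesian w → shape (map f w) ≡ shape w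
    go [] = refl
    go (split {s} {s′} m m≽ m∉s cs cs′) rewrite map-++ f s (m ∷ s′) = begin
      shape (map f s ++ f m ∷ map f s′)       ≡⟨ shape-++-∷ (map f s) (f m) (map f s′) fm≽ fm∉ ⟩
      node (shape (map f s)) (shape (map f s′)) ≡⟨ cong₂ node (go cs) (go cs′) ⟩
      node (shape s) (shape s′)               ≡⟨ sym (shape-++-∷ s m s′ m≽ m∉s) ⟩
      shape (s ++ m ∷ s′)                     ∎
      where
      open ≡-Reasoning
      fm≽ : All (f m ≽_) (map f s ++ map f s′)
      fm≽ = subst (All (f m ≽_)) (map-++ f s s′) (map⁺ (All.map (λ {y} m≽y → trans (f-hom m y) (cong f m≽y)) m≽))
      fm∉ : All (f m ≢_) (map f s)
      fm∉ = map⁺ (All.map (λ m≢y fm≡fy → m≢y (f-inj fm≡fy)) m∉s)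

-- The shapes σbaxt

inctreeF-[] : ∀ n → inctreeF n [] ≡ lleaf
inctreeF-[] zero = refl
inctreeF-[] (suc n) = refl

inctreeF-∷ : ∀ n x w → inctreeF (suc n) (x ∷ w) ≡
  lnode (inctreeF n (proj₁ (splitAtLetter (minW x w) (x ∷ w)))) (minW x w)
        (inctreeF n (proj₂ (splitAtLetter (minW x w) (x ∷ w))))
inctreeF-∷ n x w with splitAtLetter (minW x w) (x ∷ w)
... | (s , s′) = refl

dectreeF-[] : ∀ n → dectreeF n [] ≡ lleaf
dectreeF-[] zero = refl
dectreeF-[] (suc n) = refl

dectreeF-∷ : ∀ n x w → dectreeF (suc n) (x ∷ w) ≡
  lnode (dectreeF n (proj₁ (splitAtLetter (maxW x w) (x ∷ w)))) (maxW x w)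
        (dectreeF n (proj₂ (splitAtLetter (maxW x w) (x ∷ w))))
dectreeF-∷ n x w with splitAtLetter (maxW x w) (x ∷ w)
... | (s , s′) = refl

module Inc = CartesianShape _⊓_ ⊓-comm ⊓-assoc ⊓-sel minW (λ _ → refl) (λ _ _ _ → refl) inctreeF inctreeF-[] inctreeF-∷
module Dec = CartesianShape _⊔_ ⊔-comm ⊔-assoc ⊔-sel maxW (λ _ → refl) (λ _ _ _ → refl) dectreeF dectreeF-[] dectreeF-∷

baxt : Word → Tree × Tree
baxt ρ = Inc.shape ρ , Dec.shape ρ

stepʳ : ℕ → Tree × Tree → Tree × Tree
stepʳ i (t₁ , t₂) = insertNode i t₁ , node (takeNodes i t₂) (dropNodes i t₂)

stepˡ : ℕ → Tree × Tree → Tree × Tree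
stepˡ i (t₁ , t₂) = node (takeNodes i t₁) (dropNodes i t₁) , insertNode i t₂

baxt-insertAt-max : ∀ i n ρ → All (_≤ n) ρ → baxt (insertAt i (suc n) ρ) ≡ stepʳ i (baxt ρ)
baxt-insertAt-max i n ρ ρ≤n = cong₂ _,_
  (Inc.shape-insertAt-dominated (Inc.cartesian ρ) i (suc n) (All.map (λ y≤n → m≤n⇒m⊓n≡m (m≤n⇒m≤1+n y≤n)) ρ≤n) n+1∉ρ)
  (Dec.shape-insertAt-dominant ρ i (suc n) (All.map (λ y≤n → m≥n⇒m⊔n≡m (m≤n⇒m≤1+n y≤n)) ρ≤n) n+1∉ρ)
  where
  n+1∉ρ : All (suc n ≢_) ρ
  n+1∉ρ = All.map (λ y≤n n+1≡y → <⇒≢ (s≤s y≤n) (sym n+1≡y)) ρ≤n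

baxt-insertAt-min : ∀ i ρ → All (_≢ 0) ρ → baxt (insertAt i 1 (map suc ρ)) ≡ stepˡ i (baxt ρ)
baxt-insertAt-min i ρ ρ≢0 = cong₂ _,_
  (trans (Inc.shape-insertAt-dominant (map suc ρ) i 1 (map⁺ (All.universal (λ _ → refl) ρ)) 1∉ρ′)
         (cong (λ t → node (takeNodes i t) (dropNodes i t)) (Inc.shape-map (λ _ _ → refl) suc-injective ρ)))
  (trans (Dec.shape-insertAt-dominated (Dec.cartesian (map suc ρ)) i 1 (map⁺ (All.universal (λ y → cong suc (⊔-identityʳ y)) ρ)) 1∉ρ′)
         (cong (insertNode i) (Dec.shape-map (λ _ _ → refl) suc-injective ρ)))
  where
  1∉ρ′ : All (1 ≢_) (map suc ρ)
  1∉ρ′ = map⁺ (All.map (λ y≢0 1≡y+1 → y≢0 (sym (suc-injective 1≡y+1))) ρ≢0)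

σbaxt-∷ʳ : ∀ u a → σbaxt (u ∷ʳ a) ≡ stepʳ (countLess (suc a) u) (σbaxt u)
σbaxt-∷ʳ u a = begin
  baxt (inverse (std (u ∷ʳ a)))                        ≡⟨ cong (baxt ∘ inverse) (std-∷ʳ u a) ⟩
  baxt (inverse (map (shift (suc i)) π ∷ʳ suc i))      ≡⟨ cong baxt (inverse-shift-∷ʳ π i i≤n) ⟩
  baxt (insertAt i (suc (length π)) (inverse π))       ≡⟨ baxt-insertAt-max i (length π) (inverse π) (inverse-≤-length π) ⟩
  stepʳ i (baxt (inverse π))                           ∎
  where
  open ≡-Reasoning
  π = std u
  i = countLess (suc a) u
  i≤n : i ≤ length π
  i≤n = subst (i ≤_) (sym (length-std u)) (countLess-≤-length (suc a) u)

σbaxt-∷ : ∀ u a → σbaxt (a ∷ u) ≡ stepˡ (countLess a u) (σbaxt u)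
σbaxt-∷ u a = begin
  baxt (inverse (std (a ∷ u)))                         ≡⟨ cong (baxt ∘ inverse) (std-∷ u a) ⟩
  baxt (inverse (suc i ∷ map (shift (suc i)) π))       ≡⟨ cong baxt (inverse-shift-∷ π i i≤n (std-covers u)) ⟩
  baxt (insertAt i 1 (map suc (inverse π)))            ≡⟨ baxt-insertAt-min i (inverse π) (inverse-≢0 π (std-covers u)) ⟩
  stepˡ i (baxt (inverse π))                           ∎
  where
  open ≡-Reasoning
  π = std u
  i = countLess a u
  i≤n : i ≤ length π
  i≤n = subst (i ≤_) (sym (length-std u)) (countLess-≤-length a u)

proposition14 : IsAbstractShape σbaxt
proposition14 = record
  { S1 = λ u → cong (baxt ∘ inverse) (sym (std-idempotent u))
  ; S2 = λ u v a wt≡ σ≡ →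
      let open ≡-Reasoning
          countLess≡ = sameWeight⇒countLess≡ u v wt≡ in
      (begin
        σbaxt (u ∷ʳ a)                        ≡⟨ σbaxt-∷ʳ u a ⟩
        stepʳ (countLess (suc a) u) (σbaxt u) ≡⟨ cong₂ stepʳ (countLess≡ (suc a)) σ≡ ⟩
        stepʳ (countLess (suc a) v) (σbaxt v) ≡⟨ sym (σbaxt-∷ʳ v a) ⟩
        σbaxt (v ∷ʳ a)                        ∎)
      ,
      (begin
        σbaxt (a ∷ u)                        ≡⟨ σbaxt-∷ u a ⟩
        stepˡ (countLess a u) (σbaxt u)      ≡⟨ cong₂ stepˡ (countLess≡ a) σ≡ ⟩
        stepˡ (countLess a v) (σbaxt v)      ≡⟨ sym (σbaxt-∷ v a) ⟩
        σbaxt (a ∷ v)                        ∎)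
  }
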